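{- Let $p$ be an odd prime, let $t,u\in\mathbb{Z}[1/p]$ and $v\in\mathbb{Z}$, $v\neq0$, be such that the $p$-adic MCF expansion of $(t/v,u/v)$ has length $\geq n+1$. Then \[\max\{|t|_\infty,|u|_\infty,|v|_\infty\}\geq\frac{1}{3\tilde x^n}.\]
   Context: $|\cdot|_\infty$ is the real absolute value. $\tilde x$ denotes the unique positive real root of $X^3-\frac12X^2-\frac1{2p}X-\frac1{p^3}$. Browkin's $s$-function $s:\mathbb{Q}_p\to\mathbb{Z}[1/p]\cap(-p/2,p/2)$ is $s(\alpha)=\sum_{j=k}^{0}x_jp^j$ where $\alpha=\sum_{j=k}^\infty x_jp^j$, $x_j\in\mathbb{Z}\cap(-p/2,p/2)$ (empty sum $=0$ if $k>0$). The $p$-adic Jacobi–Perron algorithm applied to $(\alpha,\beta)$: $\alpha_0=\alpha,\beta_0=\beta$, and for $k\geq0$: $a_k=s(\alpha_k)$, $b_k=s(\beta_k)$, and if $\beta_k\neq b_k$, $\alpha_{k+1}=1/(\beta_k-b_k)$, $\beta_{k+1}=(\alpha_k-a_k)/(\beta_k-b_k)$; if $\beta_k=b_k$ it stops. The expansion $[(a_0,a_1,\ldots),(b_0,b_1,\ldots)]$ has length $\geq N$ if $a_N,b_N$ are defined. -}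

module Defs where

open import Data.Nat as ℕ using (ℕ; zero; suc)
open import Data.Nat.Divisibility as ℕD using (divides)
open import Data.Integer as ℤ using (ℤ; +_; -[1+_]; _◃_; sign)
open import Data.Rational as ℚ using (ℚ; mkℚ; _/_; 0ℚ; 1ℚ; ½; ↥_; ↧ₙ_)
open import Data.Rational.Properties using (_≟_)
open import Data.List using (List; []; _∷_; map; filter; upTo)
open import Data.Maybe using (Maybe; just; nothing)
open import Data.Product using (_×_; _,_; Σ)
open import Relation.Nullary using (yes; no)
open import Relation.Binary.PropositionalEquality using (_≡_)

ℕtoℚ : ℕ → ℚ
ℕtoℚ n = (+ n) / 1

ℤtoℚ : ℤ → ℚ
ℤtoℚ z = z / 1

-- total multiplicative inverse on ℚ (inv 0 = 0; only ever used on nonzero arguments)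
inv : ℚ → ℚ
inv (mkℚ (+ zero) d c) = 0ℚ
inv (mkℚ (+ (suc m)) d c) = (+ suc d) / suc m
inv (mkℚ -[1+ m ] d c) = ℤ.- (+ suc d) / suc m

pow : ℚ → ℕ → ℚ
pow q zero = 1ℚ
pow q (suc n) = q ℚ.* pow q n

-- strip p from a natural number: returns (e , d) with n = p^e * d, p ∤ d
-- (fuel-bounded; the fuel n is always sufficient for p ≥ 2, n ≥ 1)
strip : (p fuel n : ℕ) → ℕ × ℕ
strip p zero n = (0 , n)
strip p (suc fuel) n with p ℕD.∣? n
... | yes (divides q _) with strip p fuel q
...   | (e , d) = (suc e , d)
strip p (suc fuel) n | no _ = (0 , n)

-- exact division of an integer by p (0 if not divisible; only used when divisible)
exactDiv : ℕ → ℤ → ℤ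
exactDiv p m with p ℕD.∣? ℤ.∣ m ∣
... | yes (divides q _) = sign m ◃ q
... | no _ = + 0

-- the integers in (-p/2, p/2): i for 2i < p, i - p otherwise (i < p)
balanced : ℕ → List ℤ
balanced p = map (λ i → cand i) (upTo p)
  where
  cand : ℕ → ℤ
  cand i with (2 ℕ.* i) ℕ.<? p
  ... | yes _ = + i
  ... | no _ = (+ i) ℤ.- (+ p)

-- the 0-th digit of the p-integral rational N/d (p ∤ d):
-- the unique x ∈ ℤ ∩ (-p/2,p/2) with N/d ≡ x (mod p), i.e. p ∣ N - x d
digit : (p : ℕ) → ℤ → ℤ → ℤ
digit p N d with filter (λ x → p ℕD.∣? ℤ.∣ N ℤ.- x ℤ.* d ∣) (balanced p)
... | [] = + 0
... | x ∷ _ = x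

-- the first k digits y_0 ,…, y_(k-1) of N/d (p ∤ d), N/d = Σ_i y_i p^i:
-- y_0 = digit, and the remaining digits are those of (N/d - y_0)/p = ((N - y_0 d)/p)/d
digits : (p : ℕ) → ℤ → ℤ → ℕ → List ℤ
digits p N d zero = []
digits p N d (suc k) = y ∷ digits p (exactDiv p (N ℤ.- y ℤ.* d)) d k
  where y = digit p N d

evalDigits : ℕ → List ℤ → ℤ
evalDigits p [] = + 0
evalDigits p (y ∷ ys) = y ℤ.+ (+ p) ℤ.* evalDigits p ys

-- Browkin's s-function: if α = Σ_{j ≥ -e} x_j p^j (α = N/(p^e d), p ∤ d),
-- then s(α) = Σ_{j=-e}^{0} x_j p^j = (Σ_{i=0}^{e} y_i p^i) / p^e,
-- where y_i = x_(i-e) are the digits of α p^e = N/d.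
-- (If v_p(α) > 0, e = 0 and y_0 = 0, giving the empty sum 0.)
s : ℕ → ℚ → ℚ
s p α with strip p (↧ₙ α) (↧ₙ α)
... | (e , d) = ℤtoℚ (evalDigits p (digits p (↥ α) (+ d) (suc e)))
                  ℚ.* inv (ℕtoℚ (p ℕ.^ e))

JP : ℕ → ℕ → ℚ → ℚ → Maybe (ℚ × ℚ)
JP p zero α β = just (α , β)
JP p (suc k) α β with β ≟ s p β
... | yes _ = nothing
... | no _ = JP p k (inv (β ℚ.- s p β)) ((α ℚ.- s p α) ℚ.* inv (β ℚ.- s p β))

-- the expansion of (α , β) has length ≥ N : a_N , b_N are defined,
-- i.e. (α_N , β_N) is defined
LengthAtLeast : ℕ → ℕ → ℚ → ℚ → Set
LengthAtLeast p N α β with JP p N α β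
... | just _ = Data.Unit.⊤
  where import Data.Unit
... | nothing = Data.Empty.⊥
  where import Data.Empty

InZ1/p : ℕ → ℚ → Set
InZ1/p p t = Σ ℕ λ k → Σ ℤ λ a → t ℚ.* ℕtoℚ (p ℕ.^ k) ≡ ℤtoℚ a

cubic : ℕ → ℚ → ℚ
cubic p X = pow X 3 ℚ.- ½ ℚ.* pow X 2 ℚ.- inv (ℕtoℚ (2 ℕ.* p)) ℚ.* X
            ℚ.- inv (ℕtoℚ (p ℕ.^ 3))

-- x̃ is the unique positive real root of f; it is represented by its upper
-- Dedekind cut in ℚ: for rational q, x̃ < q  ⇔  q > 0 and f(q) > 0.
AboveX̃ : ℕ → ℚ → Set
AboveX̃ p q = (0ℚ ℚ.< q) × (0ℚ ℚ.< cubic p q)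

module Submission where

-- Write the k-th pair of the expansion as (α_k , β_k) = (t_k / v_k , u_k / v_k) with
-- t_k, u_k ∈ ℤ[1/p] and v_k ∈ p^k ℤ ∖ {0}.  A step of the algorithm with digits a, b
-- replaces (t, u, v) by (v, t − a v, u − b v); since β − b has positive p-adic valuation,
-- the new v = (β − b) v gains a factor p.  As |a|, |b| ≤ p/2, the potential
-- r² |v| + r |u| + |t| grows by at most the factor r = p q as soon as
-- r² (p/2) + r (p/2) + 1 ≤ r³, and this is p³ f(q) ≥ 0 for the cubic f defining x̃;
-- it also forces r ≥ 1.  After n steps,
--   r² p^n ≤ r² |v_n| ≤ r^n (r² |v| + r |u| + |t|) ≤ 3 r^(n+2) max(|t|, |u|, |v|),
-- that is, 1 ≤ 3 q^n max(|t|, |u|, |v|).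

open import Defs
open import Data.Nat using (ℕ; suc; _%_)
open import Data.Nat.Primality using (Prime)
open import Data.Integer using (ℤ; +_)
open import Data.Rational using (ℚ; 1ℚ; _≤_; _*_; _⊔_; ∣_∣)
open import Relation.Binary.PropositionalEquality using (_≡_; _≢_)

open import Data.Nat as ℕ using (zero)
import Data.Nat.Properties as ℕP
import Data.Nat.DivMod as ℕDM
open import Data.Nat.Divisibility as ℕD using (divides)
open import Data.Nat.Primality
  using (prime⇒irreducible; prime⇒nonZero; prime⇒nonTrivial; euclidsLemma)
open import Data.Nat.Coprimality as C using (Coprime)
open import Data.Nat.GCD using (module Bézout)
open import Data.Integer as ℤ using (-[1+_]; +[1+_]; sign; _◃_)
import Data.Integer.Properties as ℤP
import Data.Integer.DivMod as ℤDM
open import Data.Integer.Divisibility.Signed as ℤD using (divides)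
import Data.Sign as Sign
import Data.Sign.Properties as SignP
open import Data.Rational as ℚ using (mkℚ; 0ℚ; ½; _+_; _-_; -_; _<_; NonZero; 1/_)
import Data.Rational.Properties as ℚP
import Data.Rational.Unnormalised as ℚᵘ
import Data.Rational.Unnormalised.Properties as ℚᵘP
import Data.Nat.Solver
import Data.Integer.Solver
import Data.Rational.Solver
open import Data.List using (_∷_; []; filter)
open import Data.List.Membership.Propositional using (_∈_)
open import Data.List.Membership.Propositional.Properties
  using (∈-map⁺; ∈-map⁻; ∈-upTo⁺; ∈-upTo⁻; ∈-filter⁺; ∈-filter⁻)
open import Data.List.Relation.Unary.Any using (here)
open import Data.Maybe using (just)
open import Data.Product using (Σ; ∃; ∃₂; _×_; _,_; proj₁; proj₂)
open import Data.Sum using (inj₁; inj₂)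
open import Function using (_∋_)
open import Relation.Nullary using (¬_; yes; no; contradiction)
open import Relation.Binary.PropositionalEquality
  using (refl; sym; trans; cong; cong₂; subst; subst₂; module ≡-Reasoning)

private
  module ℕSolver = Data.Nat.Solver.+-*-Solver
  module ℤSolver = Data.Integer.Solver.+-*-Solver
  module ℚSolver = Data.Rational.Solver.+-*-Solver

ℤtoℚ≡mkℚ : ∀ i → ℤtoℚ i ≡ mkℚ i 0 (C.sym (C.1-coprimeTo ℤ.∣ i ∣))
ℤtoℚ≡mkℚ (+ n)    = ℚP.normalize-coprime (C.sym (C.1-coprimeTo n))
ℤtoℚ≡mkℚ -[1+ n ] = cong -_ (ℚP.normalize-coprime (C.sym (C.1-coprimeTo (suc n))))

ℤtoℚ-homo-+ : ∀ i j → ℤtoℚ (i ℤ.+ j) ≡ ℤtoℚ i + ℤtoℚ j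
ℤtoℚ-homo-+ i j = begin
  ℤtoℚ (i ℤ.+ j)                 ≡⟨ cong₂ (λ a b → ℤtoℚ (a ℤ.+ b)) (ℤP.*-identityʳ i) (ℤP.*-identityʳ j) ⟨
  ℤtoℚ (i ℤ.* + 1 ℤ.+ j ℤ.* + 1) ≡⟨ cong₂ _+_ (ℤtoℚ≡mkℚ i) (ℤtoℚ≡mkℚ j) ⟨
  ℤtoℚ i + ℤtoℚ j                ∎
  where open ≡-Reasoning

ℤtoℚ-homo-* : ∀ i j → ℤtoℚ (i ℤ.* j) ≡ ℤtoℚ i * ℤtoℚ j
ℤtoℚ-homo-* i j = sym (cong₂ _*_ (ℤtoℚ≡mkℚ i) (ℤtoℚ≡mkℚ j))

ℤtoℚ-homo-neg : ∀ i → ℤtoℚ (ℤ.- i) ≡ - ℤtoℚ i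
ℤtoℚ-homo-neg (+ zero)  = refl
ℤtoℚ-homo-neg +[1+ n ]  = refl
ℤtoℚ-homo-neg -[1+ n ]  = trans (ℤtoℚ≡mkℚ +[1+ n ]) (cong -_ (sym (ℤtoℚ≡mkℚ -[1+ n ])))

ℤtoℚ-homo-sub : ∀ i j → ℤtoℚ (i ℤ.- j) ≡ ℤtoℚ i - ℤtoℚ j
ℤtoℚ-homo-sub i j = trans (ℤtoℚ-homo-+ i (ℤ.- j)) (cong (λ y → ℤtoℚ i + y) (ℤtoℚ-homo-neg j))

ℤtoℚ-injective : ∀ {i j} → ℤtoℚ i ≡ ℤtoℚ j → i ≡ j
ℤtoℚ-injective {i} {j} eq = cong ℚ.↥_ (trans (sym (ℤtoℚ≡mkℚ i)) (trans eq (ℤtoℚ≡mkℚ j)))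

ℤtoℚ-mono-≤ : ∀ {i j} → i ℤ.≤ j → ℤtoℚ i ≤ ℤtoℚ j
ℤtoℚ-mono-≤ {i} {j} i≤j = subst₂ _≤_ (sym (ℤtoℚ≡mkℚ i)) (sym (ℤtoℚ≡mkℚ j))
  (ℚ.*≤* (subst₂ ℤ._≤_ (sym (ℤP.*-identityʳ i)) (sym (ℤP.*-identityʳ j)) i≤j))

ℤtoℚ-mono-< : ∀ {i j} → i ℤ.< j → ℤtoℚ i < ℤtoℚ j
ℤtoℚ-mono-< {i} {j} i<j = subst₂ _<_ (sym (ℤtoℚ≡mkℚ i)) (sym (ℤtoℚ≡mkℚ j))
  (ℚ.*<* (subst₂ ℤ._<_ (sym (ℤP.*-identityʳ i)) (sym (ℤP.*-identityʳ j)) i<j))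

∣ℤtoℚ∣ : ∀ i → ∣ ℤtoℚ i ∣ ≡ ℕtoℚ ℤ.∣ i ∣
∣ℤtoℚ∣ i = trans (cong ∣_∣ (ℤtoℚ≡mkℚ i)) (sym (ℤtoℚ≡mkℚ (+ ℤ.∣ i ∣)))

ℕtoℚ-homo-* : ∀ m n → ℕtoℚ (m ℕ.* n) ≡ ℕtoℚ m * ℕtoℚ n
ℕtoℚ-homo-* m n = trans (cong ℤtoℚ (ℤP.pos-* m n)) (ℤtoℚ-homo-* (+ m) (+ n))

ℕtoℚ-homo-^ : ∀ m n → ℕtoℚ (m ℕ.^ n) ≡ pow (ℕtoℚ m) n
ℕtoℚ-homo-^ m zero    = refl
ℕtoℚ-homo-^ m (suc n) = trans (ℕtoℚ-homo-* m (m ℕ.^ n)) (cong (ℕtoℚ m *_) (ℕtoℚ-homo-^ m n))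

ℕtoℚ-pos : ∀ n .{{_ : ℕ.NonZero n}} → 0ℚ < ℕtoℚ n
ℕtoℚ-pos n = ℤtoℚ-mono-< (ℤ.+<+ (ℕ.>-nonZero⁻¹ n))

ℕtoℚ-≢0 : ∀ n .{{_ : ℕ.NonZero n}} → ℕtoℚ n ≢ 0ℚ
ℕtoℚ-≢0 n n≡0 = ℚP.<-irrefl (sym n≡0) (ℕtoℚ-pos n)

*-↧ₙ≡↥ : ∀ x → x * ℕtoℚ (ℚ.↧ₙ x) ≡ ℤtoℚ (ℚ.↥ x)
*-↧ₙ≡↥ x@(mkℚ n d-1 _) = ℚP.toℚᵘ-injective (begin
  ℚ.toℚᵘ (x * ℕtoℚ (suc d-1))
    ≈⟨ ℚP.toℚᵘ-homo-* x (ℕtoℚ (suc d-1)) ⟩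
  ℚ.toℚᵘ x ℚᵘ.* ℚ.toℚᵘ (ℕtoℚ (suc d-1))
    ≡⟨ cong (λ y → ℚ.toℚᵘ x ℚᵘ.* ℚ.toℚᵘ y) (ℤtoℚ≡mkℚ (+ suc d-1)) ⟩
  ℚᵘ.mkℚᵘ (n ℤ.* + suc d-1) (suc d-1 ℕ.* 1 ℕ.∸ 1)
    ≈⟨ ℚᵘ.*≡* (trans (ℤP.*-identityʳ _) (cong (λ k → n ℤ.* + k) (sym (ℕP.*-identityʳ (suc d-1))))) ⟩
  ℚᵘ.mkℚᵘ n 0
    ≡⟨ cong ℚ.toℚᵘ (ℤtoℚ≡mkℚ n) ⟨
  ℚ.toℚᵘ (ℤtoℚ n) ∎)
  where open ℚᵘP.≃-Reasoning

inv≡1/ : ∀ x .{{_ : NonZero x}} → inv x ≡ 1/ x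
inv≡1/ (mkℚ +[1+ n ] d c) = ℚP.normalize-coprime (C.sym c)
inv≡1/ (mkℚ -[1+ n ] d c) = cong -_ (ℚP.normalize-coprime (C.sym c))

inv-inverseˡ : ∀ {x} → x ≢ 0ℚ → inv x * x ≡ 1ℚ
inv-inverseˡ {x} x≢0 = trans (cong (_* x) (inv≡1/ x {{ℚ.≢-nonZero x≢0}})) (ℚP.*-inverseˡ x {{ℚ.≢-nonZero x≢0}})

inv-inverseʳ : ∀ {x} → x ≢ 0ℚ → x * inv x ≡ 1ℚ
inv-inverseʳ {x} x≢0 = trans (ℚP.*-comm x (inv x)) (inv-inverseˡ x≢0)

*-inv-cancelʳ : ∀ x {z} → z ≢ 0ℚ → x * inv z * z ≡ x
*-inv-cancelʳ x {z} z≢0 = begin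
  x * inv z * z   ≡⟨ ℚP.*-assoc x (inv z) z ⟩
  x * (inv z * z) ≡⟨ cong (x *_) (inv-inverseˡ z≢0) ⟩
  x * 1ℚ          ≡⟨ ℚP.*-identityʳ x ⟩
  x               ∎
  where open ≡-Reasoning

*-cancelʳ-≢0 : ∀ {x y} z → z ≢ 0ℚ → x * z ≡ y * z → x ≡ y
*-cancelʳ-≢0 {x} {y} z z≢0 x*z≡y*z = begin
  x               ≡⟨ ℚP.*-identityʳ x ⟨
  x * 1ℚ          ≡⟨ cong (x *_) (inv-inverseʳ z≢0) ⟨
  x * (z * inv z) ≡⟨ ℚP.*-assoc x z (inv z) ⟨
  x * z * inv z   ≡⟨ cong (_* inv z) x*z≡y*z ⟩
  y * z * inv z   ≡⟨ ℚP.*-assoc y z (inv z) ⟩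
  y * (z * inv z) ≡⟨ cong (y *_) (inv-inverseʳ z≢0) ⟩
  y * 1ℚ          ≡⟨ ℚP.*-identityʳ y ⟩
  y               ∎
  where open ≡-Reasoning

*-≢0 : ∀ {x y} → x ≢ 0ℚ → y ≢ 0ℚ → x * y ≢ 0ℚ
*-≢0 {x} {y} x≢0 y≢0 x*y≡0 = y≢0 (begin
  y                ≡⟨ ℚP.*-identityˡ y ⟨
  1ℚ * y           ≡⟨ cong (_* y) (inv-inverseˡ x≢0) ⟨
  inv x * x * y    ≡⟨ ℚP.*-assoc (inv x) x y ⟩
  inv x * (x * y)  ≡⟨ cong (inv x *_) x*y≡0 ⟩
  inv x * 0ℚ       ≡⟨ ℚP.*-zeroʳ (inv x) ⟩
  0ℚ               ∎)
  where open ≡-Reasoning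

x≢y⇒x-y≢0 : ∀ {x y} → x ≢ y → x - y ≢ 0ℚ
x≢y⇒x-y≢0 {x} {y} x≢y x-y≡0 = x≢y (begin
  x            ≡⟨ solve 2 (λ x y → x := (x :- y) :+ y) refl x y ⟩
  x - y + y    ≡⟨ cong (_+ y) x-y≡0 ⟩
  0ℚ + y       ≡⟨ ℚP.+-identityˡ y ⟩
  y            ∎)
  where open ≡-Reasoning
        open ℚSolver

*-monoˡ-≤-nonNeg′ : ∀ {c a b} → 0ℚ ≤ c → a ≤ b → c * a ≤ c * b
*-monoˡ-≤-nonNeg′ {c} 0≤c = ℚP.*-monoˡ-≤-nonNeg c {{ℚ.nonNegative 0≤c}}

*-monoʳ-≤-nonNeg′ : ∀ {c a b} → 0ℚ ≤ c → a ≤ b → a * c ≤ b * c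
*-monoʳ-≤-nonNeg′ {c} 0≤c = ℚP.*-monoʳ-≤-nonNeg c {{ℚ.nonNegative 0≤c}}

nonNeg-* : ∀ {a b} → 0ℚ ≤ a → 0ℚ ≤ b → 0ℚ ≤ a * b
nonNeg-* {a} 0≤a 0≤b = ℚP.≤-trans (ℚP.≤-reflexive (sym (ℚP.*-zeroʳ a))) (*-monoˡ-≤-nonNeg′ 0≤a 0≤b)

pos-* : ∀ {a b} → 0ℚ < a → 0ℚ < b → 0ℚ < a * b
pos-* {a} {b} 0<a 0<b = ℚP.positive⁻¹ (a * b) {{ℚP.pos*pos⇒pos a {{ℚ.positive 0<a}} b {{ℚ.positive 0<b}}}}

0<y-x⇒x<y : ∀ {x y} → 0ℚ < y - x → x < y
0<y-x⇒x<y {x} {y} 0<y-x = begin-strict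
  x             ≡⟨ ℚP.+-identityʳ x ⟨
  x + 0ℚ        <⟨ ℚP.+-monoʳ-< x 0<y-x ⟩
  x + (y - x)   ≡⟨ solve 2 (λ x y → x :+ (y :- x) := y) refl x y ⟩
  y             ∎
  where open ℚP.≤-Reasoning
        open ℚSolver

pow-nonNeg : ∀ {x} n → 0ℚ ≤ x → 0ℚ ≤ pow x n
pow-nonNeg zero    _   = ℚP.<⇒≤ (ℚP.positive⁻¹ 1ℚ)
pow-nonNeg (suc n) 0≤x = nonNeg-* 0≤x (pow-nonNeg n 0≤x)

pow-distrib-* : ∀ x y n → pow (x * y) n ≡ pow x n * pow y n
pow-distrib-* x y zero    = refl
pow-distrib-* x y (suc n) = begin
  x * y * pow (x * y) n          ≡⟨ cong (x * y *_) (pow-distrib-* x y n) ⟩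
  x * y * (pow x n * pow y n)    ≡⟨ solve 4 (λ x y a b → x :* y :* (a :* b) := x :* a :* (y :* b)) refl x y (pow x n) (pow y n) ⟩
  x * pow x n * (y * pow y n)    ∎
  where open ≡-Reasoning
        open ℚSolver

exactDiv-correct : ∀ p {m} → + p ℤD.∣ m → m ≡ exactDiv p m ℤ.* + p
exactDiv-correct p {m} p∣m with p ℕD.∣? ℤ.∣ m ∣
... | no p∤m = contradiction (ℤD.∣⇒∣ᵤ p∣m) p∤m
... | yes (divides q ∣m∣≡q*p) = begin
  m                                  ≡⟨ ℤP.◃-inverse m ⟨
  sign m ◃ ℤ.∣ m ∣                   ≡⟨ cong (sign m ◃_) ∣m∣≡q*p ⟩
  sign m ◃ (q ℕ.* p)                 ≡⟨ cong (_◃ (q ℕ.* p)) (SignP.*-identityʳ (sign m)) ⟨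
  (sign m Sign.* Sign.+) ◃ (q ℕ.* p) ≡⟨ ℤP.◃-distrib-* (sign m) Sign.+ q p ⟩
  (sign m ◃ q) ℤ.* (Sign.+ ◃ p)      ≡⟨ cong ((sign m ◃ q) ℤ.*_) (ℤP.+◃n≡+n p) ⟩
  (sign m ◃ q) ℤ.* + p               ∎
  where open ≡-Reasoning

p∣n-n%p : ∀ p .{{_ : ℕ.NonZero p}} n → + p ℤD.∣ n ℤ.- + (n ℤDM.%ℕ p)
p∣n-n%p p n = divides (n ℤDM./ℕ p) (begin
  n ℤ.- + i               ≡⟨ cong (ℤ._- + i) (ℤDM.a≡a%ℕn+[a/ℕn]*n n p) ⟩
  + i ℤ.+ q ℤ.* + p ℤ.- + i ≡⟨ solve 3 (λ i q p → i :+ q :* p :- i := q :* p) refl (+ i) q (+ p) ⟩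
  q ℤ.* + p               ∎)
  where open ≡-Reasoning
        open ℤSolver
        i = n ℤDM.%ℕ p
        q = n ℤDM./ℕ p

balanced-complete : ∀ p .{{_ : ℕ.NonZero p}} n → ∃ λ x → x ∈ balanced p × + p ℤD.∣ n ℤ.- x
balanced-complete p n
  with x∈ ← (_ ∈ balanced p) ∋ ∈-map⁺ _ (∈-upTo⁺ (ℤDM.n%ℕd<d n p))
  with 2 ℕ.* (n ℤDM.%ℕ p) ℕ.<? p
... | yes _ = _ , x∈ , p∣n-n%p p n
... | no  _ = _ , x∈ , subst (+ p ℤD.∣_) (solve 3 (λ n i p → n :- i :+ p := n :- (i :- p)) refl n (+ (n ℤDM.%ℕ p)) (+ p))
                               (ℤD.∣m∣n⇒∣m+n (p∣n-n%p p n) ℤD.∣-refl)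
  where open ℤSolver

odd⇒2*i≢ : ∀ {p} → p % 2 ≡ 1 → ∀ i → 2 ℕ.* i ≢ p
odd⇒2*i≢ {p} p-odd i 2i≡p = contradiction (begin
  0               ≡⟨ ℕDM.m*n%n≡0 i 2 ⟨
  i ℕ.* 2 % 2     ≡⟨ cong (_% 2) (ℕP.*-comm i 2) ⟩
  2 ℕ.* i % 2     ≡⟨ cong (_% 2) 2i≡p ⟩
  p % 2           ≡⟨ p-odd ⟩
  1               ∎) λ ()
  where open ≡-Reasoning

balanced-bound : ∀ {p} → p % 2 ≡ 1 → ∀ {x} → x ∈ balanced p → 2 ℕ.* ℤ.∣ x ∣ ℕ.< p
balanced-bound {p} p-odd x∈ with ∈-map⁻ _ x∈
... | i , i∈ , refl with 2 ℕ.* i ℕ.<? p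
...   | yes 2i<p = 2i<p
...   | no  2i≮p = begin-strict
  2 ℕ.* ℤ.∣ + i ℤ.- + p ∣ ≡⟨ cong (λ z → 2 ℕ.* ℤ.∣ z ∣) (ℤP.m-n≡m⊖n i p) ⟩
  2 ℕ.* ℤ.∣ i ℤ.⊖ p ∣     ≡⟨ cong (2 ℕ.*_) (ℤP.∣⊖∣-< i<p) ⟩
  2 ℕ.* k                 ≡⟨ cong (k ℕ.+_) (ℕP.+-identityʳ k) ⟩
  k ℕ.+ k                 <⟨ ℕP.+-monoʳ-< k k<i ⟩
  k ℕ.+ i                 ≡⟨ ℕP.m∸n+n≡m (ℕP.<⇒≤ i<p) ⟩
  p                       ∎
  where
  open ℕP.≤-Reasoning
  i<p = ∈-upTo⁻ i∈
  k = p ℕ.∸ i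
  p<2i : p ℕ.< 2 ℕ.* i
  p<2i = ℕP.≤∧≢⇒< (ℕP.≮⇒≥ 2i≮p) (λ p≡2i → odd⇒2*i≢ p-odd i (sym p≡2i))
  k<i : k ℕ.< i
  k<i = ℕP.+-cancelʳ-< i k i (begin-strict
    k ℕ.+ i   ≡⟨ ℕP.m∸n+n≡m (ℕP.<⇒≤ i<p) ⟩
    p         <⟨ p<2i ⟩
    2 ℕ.* i   ≡⟨ cong (i ℕ.+_) (ℕP.+-identityʳ i) ⟩
    i ℕ.+ i   ∎)

prime∤⇒coprime : ∀ {p d} → Prime p → ¬ p ℕD.∣ d → Coprime d p
prime∤⇒coprime p-prime p∤d (i∣d , i∣p) with prime⇒irreducible p-prime i∣p
... | inj₁ i≡1    = i≡1
... | inj₂ refl   = contradiction i∣d p∤d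

invertible-mod-prime : ∀ {p d} → Prime p → ¬ p ℕD.∣ d → ∃ λ a → + p ℤD.∣ a ℤ.* + d ℤ.- + 1
invertible-mod-prime {p} {d} p-prime p∤d with C.coprime-Bézout (prime∤⇒coprime p-prime p∤d)
... | Bézout.+- x y 1+yp≡xd = + x , divides (+ y) (begin
  + x ℤ.* + d ℤ.- + 1       ≡⟨ cong (ℤ._- + 1) (ℤP.pos-* x d) ⟨
  + (x ℕ.* d) ℤ.- + 1       ≡⟨ cong (λ z → + z ℤ.- + 1) 1+yp≡xd ⟨
  + (1 ℕ.+ y ℕ.* p) ℤ.- + 1 ≡⟨ cong (ℤ._- + 1) (ℤP.pos-+ 1 (y ℕ.* p)) ⟩
  + 1 ℤ.+ + (y ℕ.* p) ℤ.- + 1 ≡⟨ solve 1 (λ z → con (+ 1) :+ z :- con (+ 1) := z) refl (+ (y ℕ.* p)) ⟩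
  + (y ℕ.* p)               ≡⟨ ℤP.pos-* y p ⟩
  + y ℤ.* + p               ∎)
  where open ≡-Reasoning
        open ℤSolver
... | Bézout.-+ x y 1+xd≡yp = ℤ.- + x , divides (ℤ.- + y) (begin
  ℤ.- + x ℤ.* + d ℤ.- + 1     ≡⟨ solve 2 (λ x d → :- x :* d :- con (+ 1) := :- (con (+ 1) :+ x :* d)) refl (+ x) (+ d) ⟩
  ℤ.- (+ 1 ℤ.+ + x ℤ.* + d)   ≡⟨ cong (λ z → ℤ.- (+ 1 ℤ.+ z)) (ℤP.pos-* x d) ⟨
  ℤ.- (+ 1 ℤ.+ + (x ℕ.* d))   ≡⟨ cong ℤ.-_ (ℤP.pos-+ 1 (x ℕ.* d)) ⟨
  ℤ.- + (1 ℕ.+ x ℕ.* d)       ≡⟨ cong (λ z → ℤ.- + z) 1+xd≡yp ⟩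
  ℤ.- + (y ℕ.* p)             ≡⟨ cong ℤ.-_ (ℤP.pos-* y p) ⟩
  ℤ.- (+ y ℤ.* + p)           ≡⟨ ℤP.neg-distribˡ-* (+ y) (+ p) ⟩
  ℤ.- + y ℤ.* + p             ∎)
  where open ≡-Reasoning
        open ℤSolver

module _ {p : ℕ} (N D : ℤ) where
  private
    P? = λ x → p ℕD.∣? ℤ.∣ N ℤ.- x ℤ.* D ∣

  digit-solves : ∀ {x} → x ∈ balanced p → + p ℤD.∣ N ℤ.- x ℤ.* D → + p ℤD.∣ N ℤ.- digit p N D ℤ.* D
  digit-solves {x} x∈ p∣N-xD with filter P? (balanced p) in eq
  ... | y ∷ _ = ℤD.∣ᵤ⇒∣ (proj₂ (∈-filter⁻ P? {xs = balanced p} (subst (y ∈_) (sym eq) (here refl))))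
  ... | []    with () ← subst (x ∈_) eq (∈-filter⁺ P? x∈ (ℤD.∣⇒∣ᵤ p∣N-xD))

  digit-bound : p % 2 ≡ 1 → 2 ℕ.* ℤ.∣ digit p N D ∣ ℕ.< p
  digit-bound p-odd with filter P? (balanced p) in eq
  ... | y ∷ _ = balanced-bound p-odd (proj₁ (∈-filter⁻ P? {xs = balanced p} (subst (y ∈_) (sym eq) (here refl))))
  ... | []    = ℕP.n≢0⇒n>0 λ p≡0 → contradiction (trans (cong (_% 2) (sym p≡0)) p-odd) λ ()

digit-correct : ∀ {p d} → Prime p → ¬ p ℕD.∣ d → ∀ N → + p ℤD.∣ N ℤ.- digit p N (+ d) ℤ.* + d
digit-correct {p} {d} p-prime p∤d N
  with a , p∣ad-1 ← invertible-mod-prime p-prime p∤d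
  with x , x∈ , p∣Na-x ← balanced-complete p {{prime⇒nonZero p-prime}} (N ℤ.* a)
  = digit-solves N (+ d) x∈ (subst (+ p ℤD.∣_) [Na-x]d-N[ad-1]≡N-xd
      (ℤD.∣m∣n⇒∣m-n (ℤD.∣m⇒∣m*n (+ d) p∣Na-x) (ℤD.∣n⇒∣m*n N p∣ad-1)))
  where
  open ℤSolver
  [Na-x]d-N[ad-1]≡N-xd = solve 4 (λ N a x d → (N :* a :- x) :* d :- N :* (a :* d :- con (+ 1)) := N :- x :* d)
                           refl N a x (+ d)

digits-correct : ∀ {p d} → Prime p → ¬ p ℕD.∣ d → ∀ L N →
  + (p ℕ.^ L) ℤD.∣ N ℤ.- evalDigits p (digits p N (+ d) L) ℤ.* + d
digits-correct {p} {d} _ _ zero N = divides (N ℤ.- + 0 ℤ.* + d) (sym (ℤP.*-identityʳ _))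
digits-correct {p} {d} p-prime p∤d (suc L) N =
  subst₂ ℤD._∣_ (sym (ℤP.pos-* p (p ℕ.^ L))) (sym remainder≡)
    (ℤD.*-monoʳ-∣ (+ p) (digits-correct p-prime p∤d L N₁))
  where
  y  = digit p N (+ d)
  N₁ = exactDiv p (N ℤ.- y ℤ.* + d)
  E  = evalDigits p (digits p N₁ (+ d) L)
  remainder≡ : N ℤ.- (y ℤ.+ + p ℤ.* E) ℤ.* + d ≡ + p ℤ.* (N₁ ℤ.- E ℤ.* + d)
  remainder≡ = begin
    N ℤ.- (y ℤ.+ + p ℤ.* E) ℤ.* + d
      ≡⟨ solve 5 (λ N y p E d → N :- (y :+ p :* E) :* d := (N :- y :* d) :- p :* E :* d) refl N y (+ p) E (+ d) ⟩
    (N ℤ.- y ℤ.* + d) ℤ.- + p ℤ.* E ℤ.* + d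
      ≡⟨ cong (ℤ._- + p ℤ.* E ℤ.* + d) (exactDiv-correct p (digit-correct p-prime p∤d N)) ⟩
    N₁ ℤ.* + p ℤ.- + p ℤ.* E ℤ.* + d
      ≡⟨ solve 4 (λ N₁ p E d → N₁ :* p :- p :* E :* d := p :* (N₁ :- E :* d)) refl N₁ (+ p) E (+ d) ⟩
    + p ℤ.* (N₁ ℤ.- E ℤ.* + d) ∎
    where open ≡-Reasoning
          open ℤSolver

digits-bound : ∀ {p} → p % 2 ≡ 1 → ∀ L N D → 2 ℕ.* ℤ.∣ evalDigits p (digits p N D L) ∣ ℕ.< p ℕ.^ L
digits-bound p-odd zero N D = ℕ.z<s
digits-bound {p} p-odd (suc L) N D = begin-strict
  2 ℕ.* ℤ.∣ y ℤ.+ + p ℤ.* E ∣         ≤⟨ ℕP.*-monoʳ-≤ 2 (ℤP.∣i+j∣≤∣i∣+∣j∣ y (+ p ℤ.* E)) ⟩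
  2 ℕ.* (ℤ.∣ y ∣ ℕ.+ ℤ.∣ + p ℤ.* E ∣) ≡⟨ cong (λ z → 2 ℕ.* (ℤ.∣ y ∣ ℕ.+ z)) (ℤP.abs-* (+ p) E) ⟩
  2 ℕ.* (ℤ.∣ y ∣ ℕ.+ p ℕ.* ℤ.∣ E ∣)
    ≡⟨ solve 3 (λ y p e → con 2 :* (y :+ p :* e) := con 2 :* y :+ p :* (con 2 :* e)) refl ℤ.∣ y ∣ p ℤ.∣ E ∣ ⟩
  2 ℕ.* ℤ.∣ y ∣ ℕ.+ p ℕ.* (2 ℕ.* ℤ.∣ E ∣)
    <⟨ ℕP.+-monoˡ-< (p ℕ.* (2 ℕ.* ℤ.∣ E ∣)) (digit-bound {p} N D p-odd) ⟩
  p ℕ.+ p ℕ.* (2 ℕ.* ℤ.∣ E ∣)          ≡⟨ ℕP.*-suc p (2 ℕ.* ℤ.∣ E ∣) ⟨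
  p ℕ.* suc (2 ℕ.* ℤ.∣ E ∣)            ≤⟨ ℕP.*-monoʳ-≤ p (digits-bound p-odd L _ D) ⟩
  p ℕ.* p ℕ.^ L                        ∎
  where
  open ℕP.≤-Reasoning
  open ℕSolver
  y = digit p N D
  E = evalDigits p (digits p (exactDiv p (N ℤ.- y ℤ.* D)) D L)

strip-correct : ∀ {p} → 1 ℕ.< p → ∀ fuel n .{{_ : ℕ.NonZero n}} → n ℕ.≤ fuel →
  n ≡ p ℕ.^ proj₁ (strip p fuel n) ℕ.* proj₂ (strip p fuel n) × ¬ p ℕD.∣ proj₂ (strip p fuel n)
strip-correct p>1 zero n n≤0 = contradiction (ℕP.n≤0⇒n≡0 n≤0) (ℕ.≢-nonZero⁻¹ n)
strip-correct {p} p>1 (suc fuel) n n≤1+fuel with p ℕD.∣? n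
... | no p∤n = sym (ℕP.*-identityˡ n) , p∤n
... | yes (divides zero n≡0) = contradiction n≡0 (ℕ.≢-nonZero⁻¹ n)
... | yes (divides q@(suc _) n≡q*p)
  with q≡ , p∤d ← strip-correct p>1 fuel q
                     (ℕP.<⇒≤pred (ℕP.<-≤-trans (subst (q ℕ.<_) (sym n≡q*p) (ℕP.m<m*n q p p>1)) n≤1+fuel)) = (begin
    n                    ≡⟨ n≡q*p ⟩
    q ℕ.* p              ≡⟨ cong (ℕ._* p) q≡ ⟩
    p ℕ.^ e ℕ.* d ℕ.* p  ≡⟨ solve 3 (λ a d p → a :* d :* p := p :* a :* d) refl (p ℕ.^ e) d p ⟩
    p ℕ.* p ℕ.^ e ℕ.* d  ∎) , p∤d
  where
  open ≡-Reasoning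
  open ℕSolver
  e = proj₁ (strip p fuel q)
  d = proj₂ (strip p fuel q)

potential : ℚ → ℚ → ℚ → ℚ → ℚ
potential r t u v = r * r * ∣ v ∣ + r * ∣ u ∣ + ∣ t ∣

∣x-a*y∣≤∣x∣+h*∣y∣ : ∀ {h} x a y → ∣ a ∣ ≤ h → ∣ x - a * y ∣ ≤ ∣ x ∣ + h * ∣ y ∣
∣x-a*y∣≤∣x∣+h*∣y∣ {h} x a y ∣a∣≤h = begin
  ∣ x - a * y ∣         ≤⟨ ℚP.∣p-q∣≤∣p∣+∣q∣ x (a * y) ⟩
  ∣ x ∣ + ∣ a * y ∣     ≡⟨ cong (λ z → ∣ x ∣ + z) (ℚP.∣p*q∣≡∣p∣*∣q∣ a y) ⟩
  ∣ x ∣ + ∣ a ∣ * ∣ y ∣ ≤⟨ ℚP.+-monoʳ-≤ ∣ x ∣ (*-monoʳ-≤-nonNeg′ (ℚP.0≤∣p∣ y) ∣a∣≤h) ⟩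
  ∣ x ∣ + h * ∣ y ∣     ∎
  where open ℚP.≤-Reasoning

potential-contracts : ∀ {r h} a b t u v → 0ℚ ≤ r → ∣ a ∣ ≤ h → ∣ b ∣ ≤ h →
  r * r * h + r * h + 1ℚ ≤ r * r * r →
  potential r v (t - a * v) (u - b * v) ≤ r * potential r t u v
potential-contracts {r} {h} a b t u v 0≤r ∣a∣≤h ∣b∣≤h r²h+rh+1≤r³ = begin
  r * r * (∣ u - b * v ∣) + r * (∣ t - a * v ∣) + (∣ v ∣)
    ≤⟨ ℚP.+-monoˡ-≤ (∣ v ∣) (ℚP.+-mono-≤
         (*-monoˡ-≤-nonNeg′ (nonNeg-* 0≤r 0≤r) (∣x-a*y∣≤∣x∣+h*∣y∣ u b v ∣b∣≤h))
         (*-monoˡ-≤-nonNeg′ 0≤r (∣x-a*y∣≤∣x∣+h*∣y∣ t a v ∣a∣≤h))) ⟩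
  r * r * ((∣ u ∣) + h * (∣ v ∣)) + r * ((∣ t ∣) + h * (∣ v ∣)) + (∣ v ∣)
    ≡⟨ solve 5 (λ r h u t v → r :* r :* (u :+ h :* v) :+ r :* (t :+ h :* v) :+ v
                              := r :* r :* u :+ r :* t :+ (r :* r :* h :+ r :* h :+ con 1ℚ) :* v)
               refl r h (∣ u ∣) (∣ t ∣) (∣ v ∣) ⟩
  r * r * (∣ u ∣) + r * (∣ t ∣) + (r * r * h + r * h + 1ℚ) * (∣ v ∣)
    ≤⟨ ℚP.+-monoʳ-≤ (r * r * (∣ u ∣) + r * (∣ t ∣)) (*-monoʳ-≤-nonNeg′ (ℚP.0≤∣p∣ v) r²h+rh+1≤r³) ⟩
  r * r * (∣ u ∣) + r * (∣ t ∣) + r * r * r * (∣ v ∣)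
    ≡⟨ solve 4 (λ r u t v → r :* r :* u :+ r :* t :+ r :* r :* r :* v := r :* (r :* r :* v :+ r :* u :+ t))
               refl r (∣ u ∣) (∣ t ∣) (∣ v ∣) ⟩
  r * (r * r * (∣ v ∣) + r * (∣ u ∣) + (∣ t ∣)) ∎
  where open ℚP.≤-Reasoning
        open ℚSolver

contraction⇒1≤r : ∀ {r h} → 0ℚ ≤ r → 0ℚ ≤ h → r * r * h + r * h + 1ℚ ≤ r * r * r → 1ℚ ≤ r
contraction⇒1≤r {r} {h} 0≤r 0≤h r²h+rh+1≤r³ with ℚP.≤-total 1ℚ r
... | inj₁ 1≤r = 1≤r
... | inj₂ r≤1 = begin
  1ℚ                      ≡⟨ ℚP.+-identityˡ 1ℚ ⟨
  0ℚ + 1ℚ                 ≤⟨ ℚP.+-monoˡ-≤ 1ℚ (ℚP.+-mono-≤ (nonNeg-* (nonNeg-* 0≤r 0≤r) 0≤h) (nonNeg-* 0≤r 0≤h)) ⟩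
  r * r * h + r * h + 1ℚ  ≤⟨ r²h+rh+1≤r³ ⟩
  r * r * r               ≤⟨ *-monoʳ-≤-nonNeg′ 0≤r r²≤1 ⟩
  1ℚ * r                  ≡⟨ ℚP.*-identityˡ r ⟩
  r                       ∎
  where
  open ℚP.≤-Reasoning
  r²≤1 : r * r ≤ 1ℚ
  r²≤1 = ℚP.≤-trans (*-monoˡ-≤-nonNeg′ 0≤r r≤1) (ℚP.≤-trans (ℚP.≤-reflexive (ℚP.*-identityʳ r)) r≤1)

potential≤3r²max : ∀ {r} t u v → 1ℚ ≤ r → potential r t u v ≤ ℕtoℚ 3 * (r * r) * (∣ t ∣ ⊔ ∣ u ∣ ⊔ ∣ v ∣)
potential≤3r²max {r} t u v 1≤r = begin
  r * r * (∣ v ∣) + r * (∣ u ∣) + (∣ t ∣)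
    ≤⟨ ℚP.+-mono-≤ (ℚP.+-mono-≤ (*-monoˡ-≤-nonNeg′ 0≤r² ∣v∣≤M) (*-monoˡ-≤-nonNeg′ 0≤r ∣u∣≤M)) ∣t∣≤M ⟩
  r * r * M + r * M + M
    ≤⟨ ℚP.+-mono-≤ (ℚP.+-monoʳ-≤ (r * r * M) (*-monoʳ-≤-nonNeg′ 0≤M r≤r²))
                   (ℚP.≤-trans (ℚP.≤-reflexive (sym (ℚP.*-identityˡ M)))
                               (*-monoʳ-≤-nonNeg′ 0≤M (ℚP.≤-trans 1≤r r≤r²))) ⟩
  r * r * M + r * r * M + r * r * M
    ≡⟨ solve 2 (λ r M → r :* r :* M :+ r :* r :* M :+ r :* r :* M := con (ℕtoℚ 3) :* (r :* r) :* M) refl r M ⟩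
  ℕtoℚ 3 * (r * r) * M ∎
  where
  open ℚP.≤-Reasoning
  open ℚSolver
  M = ∣ t ∣ ⊔ ∣ u ∣ ⊔ ∣ v ∣
  ∣t∣≤M = ℚP.≤-trans (ℚP.p≤p⊔q (∣ t ∣) (∣ u ∣)) (ℚP.p≤p⊔q (∣ t ∣ ⊔ ∣ u ∣) (∣ v ∣))
  ∣u∣≤M = ℚP.≤-trans (ℚP.p≤q⊔p (∣ t ∣) (∣ u ∣)) (ℚP.p≤p⊔q (∣ t ∣ ⊔ ∣ u ∣) (∣ v ∣))
  ∣v∣≤M = ℚP.p≤q⊔p (∣ t ∣ ⊔ ∣ u ∣) (∣ v ∣)
  0≤M = ℚP.≤-trans (ℚP.0≤∣p∣ t) ∣t∣≤M
  0≤r = ℚP.≤-trans (ℚP.<⇒≤ (ℚP.positive⁻¹ 1ℚ)) 1≤r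
  0≤r² = nonNeg-* 0≤r 0≤r
  r≤r² : r ≤ r * r
  r≤r² = ℚP.≤-trans (ℚP.≤-reflexive (sym (ℚP.*-identityʳ r))) (*-monoˡ-≤-nonNeg′ 0≤r 1≤r)

r²∣v∣≤potential : ∀ {r} t u v → 0ℚ ≤ r → r * r * ∣ v ∣ ≤ potential r t u v
r²∣v∣≤potential {r} t u v 0≤r = begin
  r * r * (∣ v ∣)                          ≡⟨ ℚP.+-identityʳ _ ⟨
  r * r * (∣ v ∣) + 0ℚ                     ≤⟨ ℚP.+-monoʳ-≤ (r * r * (∣ v ∣)) (nonNeg-* 0≤r (ℚP.0≤∣p∣ u)) ⟩
  r * r * (∣ v ∣) + r * (∣ u ∣)            ≡⟨ ℚP.+-identityʳ _ ⟨
  r * r * (∣ v ∣) + r * (∣ u ∣) + 0ℚ       ≤⟨ ℚP.+-monoʳ-≤ (r * r * (∣ v ∣) + r * (∣ u ∣)) (ℚP.0≤∣p∣ t) ⟩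
  r * r * (∣ v ∣) + r * (∣ u ∣) + (∣ t ∣)  ∎
  where open ℚP.≤-Reasoning

JP-suc : ∀ {p} N α β {x} → JP p (suc N) α β ≡ just x →
  β ≢ s p β × JP p N (inv (β - s p β)) ((α - s p α) * inv (β - s p β)) ≡ just x
JP-suc {p} N α β JP≡ with β ℚP.≟ s p β
... | no β≢b = β≢b , JP≡

JP-suc⇒JP : ∀ {p} N α β {x} → JP p (suc N) α β ≡ just x → ∃ λ y → JP p N α β ≡ just y
JP-suc⇒JP zero    α β _ = (α , β) , refl
JP-suc⇒JP {p} (suc N) α β JP≡ with β ℚP.≟ s p β
... | no _ = JP-suc⇒JP N _ _ JP≡

lengthAtLeast⇒JP : ∀ {p} N α β → LengthAtLeast p N α β → ∃ λ x → JP p N α β ≡ just x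
lengthAtLeast⇒JP {p} N α β _ with JP p N α β
... | just x = x , refl

module JacobiPerron {p : ℕ} (p-prime : Prime p) where

  private instance
    p≢0 : ℕ.NonZero p
    p≢0 = prime⇒nonZero p-prime

  P : ℚ
  P = ℕtoℚ p

  P-pos : 0ℚ < P
  P-pos = ℕtoℚ-pos p

  p^ : ℕ → ℚ
  p^ k = ℕtoℚ (p ℕ.^ k)

  p^-pos : ∀ k → 0ℚ < p^ k
  p^-pos k = ℕtoℚ-pos (p ℕ.^ k) {{ℕP.m^n≢0 p k}}

  p^≢0 : ∀ k → p^ k ≢ 0ℚ
  p^≢0 k = ℕtoℚ-≢0 (p ℕ.^ k) {{ℕP.m^n≢0 p k}}

  module _ (α : ℚ) where
    private
      e = proj₁ (strip p (ℚ.↧ₙ α) (ℚ.↧ₙ α))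
      d = proj₂ (strip p (ℚ.↧ₙ α) (ℚ.↧ₙ α))
      E = evalDigits p (digits p (ℚ.↥ α) (+ d) (suc e))
      stripped : ℚ.↧ₙ α ≡ p ℕ.^ e ℕ.* d × ¬ p ℕD.∣ d
      stripped = strip-correct (ℕ.nonTrivial⇒n>1 p {{prime⇒nonTrivial p-prime}}) (ℚ.↧ₙ α) (ℚ.↧ₙ α) ℕP.≤-refl
      s*p^e≡E : s p α * p^ e ≡ ℤtoℚ E
      s*p^e≡E = *-inv-cancelʳ (ℤtoℚ E) (p^≢0 e)

    s∈ℤ[1/p] : InZ1/p p (s p α)
    s∈ℤ[1/p] = e , E , s*p^e≡E

    ∣s∣≤½p : p % 2 ≡ 1 → ∣ s p α ∣ ≤ ½ * P
    ∣s∣≤½p p-odd = ℚP.*-cancelʳ-≤-pos (p^ e) {{ℚ.positive (p^-pos e)}} (begin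
      ∣ s p α ∣ * p^ e             ≡⟨ cong (∣ s p α ∣ *_) (ℚP.0≤p⇒∣p∣≡p (ℚP.<⇒≤ (p^-pos e))) ⟨
      ∣ s p α ∣ * ∣ p^ e ∣         ≡⟨ ℚP.∣p*q∣≡∣p∣*∣q∣ (s p α) (p^ e) ⟨
      ∣ s p α * p^ e ∣             ≡⟨ trans (cong ∣_∣ s*p^e≡E) (∣ℤtoℚ∣ E) ⟩
      ℕtoℚ ℤ.∣ E ∣                 ≡⟨ solve 1 (λ x → x := con ½ :* (con (ℕtoℚ 2) :* x)) refl (ℕtoℚ ℤ.∣ E ∣) ⟩
      ½ * (ℕtoℚ 2 * ℕtoℚ ℤ.∣ E ∣)  ≡⟨ cong (½ *_) (ℕtoℚ-homo-* 2 ℤ.∣ E ∣) ⟨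
      ½ * ℕtoℚ (2 ℕ.* ℤ.∣ E ∣)     ≤⟨ ℚP.*-monoˡ-≤-nonNeg ½ (ℤtoℚ-mono-≤ (ℤ.+≤+ (ℕP.<⇒≤ 2∣E∣<p^[1+e]))) ⟩
      ½ * ℕtoℚ (p ℕ.* p ℕ.^ e)     ≡⟨ cong (½ *_) (ℕtoℚ-homo-* p (p ℕ.^ e)) ⟩
      ½ * (P * p^ e)               ≡⟨ ℚP.*-assoc ½ P (p^ e) ⟨
      ½ * P * p^ e                 ∎)
      where open ℚP.≤-Reasoning
            open ℚSolver
            2∣E∣<p^[1+e] = digits-bound {p} p-odd (suc e) (ℚ.↥ α) (+ d)

    -- α − s(α) has positive p-adic valuation.
    s-remainder : ∃₂ λ d K → ¬ p ℕD.∣ d × (α - s p α) * ℕtoℚ d ≡ P * ℤtoℚ K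
    s-remainder = d , K , p∤d , *-cancelʳ-≢0 (p^ e) (p^≢0 e) (begin
      (α - s p α) * ℕtoℚ d * p^ e
        ≡⟨ solve 4 (λ a s d x → (a :- s) :* d :* x := a :* (x :* d) :- (s :* x) :* d) refl α (s p α) (ℕtoℚ d) (p^ e) ⟩
      α * (p^ e * ℕtoℚ d) - (s p α * p^ e) * ℕtoℚ d
        ≡⟨ cong₂ (λ x y → α * x - y * ℕtoℚ d)
                 (trans (sym (ℕtoℚ-homo-* (p ℕ.^ e) d)) (cong ℕtoℚ (sym ↧≡p^e*d))) s*p^e≡E ⟩
      α * ℕtoℚ (ℚ.↧ₙ α) - ℤtoℚ E * ℕtoℚ d
        ≡⟨ cong₂ _-_ (*-↧ₙ≡↥ α) (sym (ℤtoℚ-homo-* E (+ d))) ⟩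
      ℤtoℚ (ℚ.↥ α) - ℤtoℚ (E ℤ.* + d)
        ≡⟨ ℤtoℚ-homo-sub (ℚ.↥ α) (E ℤ.* + d) ⟨
      ℤtoℚ (ℚ.↥ α ℤ.- E ℤ.* + d)
        ≡⟨ cong ℤtoℚ (ℤD._∣_.equality p^[1+e]∣) ⟩
      ℤtoℚ (K ℤ.* + (p ℕ.* p ℕ.^ e))
        ≡⟨ trans (ℤtoℚ-homo-* K _) (cong (ℤtoℚ K *_) (ℕtoℚ-homo-* p (p ℕ.^ e))) ⟩
      ℤtoℚ K * (P * p^ e)
        ≡⟨ solve 3 (λ k P x → k :* (P :* x) := P :* k :* x) refl (ℤtoℚ K) P (p^ e) ⟩
      P * ℤtoℚ K * p^ e ∎)
      where
      open ≡-Reasoning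
      open ℚSolver
      ↧≡p^e*d = proj₁ stripped
      p∤d = proj₂ stripped
      p^[1+e]∣ = digits-correct p-prime p∤d (suc e) (ℚ.↥ α)
      K = ℤD._∣_.quotient p^[1+e]∣

  p^-+ : ∀ j k → p^ (j ℕ.+ k) ≡ p^ j * p^ k
  p^-+ j k = trans (cong ℕtoℚ (ℕP.^-distribˡ-+-* p j k)) (ℕtoℚ-homo-* (p ℕ.^ j) (p ℕ.^ k))

  InZ1/p-sub : ∀ {x y} → InZ1/p p x → InZ1/p p y → InZ1/p p (x - y)
  InZ1/p-sub {x} {y} (j , a , x*p^j≡a) (k , b , y*p^k≡b) =
    j ℕ.+ k , a ℤ.* + (p ℕ.^ k) ℤ.- b ℤ.* + (p ℕ.^ j) , (begin
      (x - y) * p^ (j ℕ.+ k)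
        ≡⟨ cong ((x - y) *_) (p^-+ j k) ⟩
      (x - y) * (p^ j * p^ k)
        ≡⟨ solve 4 (λ x y a b → (x :- y) :* (a :* b) := (x :* a) :* b :- (y :* b) :* a) refl x y (p^ j) (p^ k) ⟩
      (x * p^ j) * p^ k - (y * p^ k) * p^ j
        ≡⟨ cong₂ (λ u w → u * p^ k - w * p^ j) x*p^j≡a y*p^k≡b ⟩
      ℤtoℚ a * p^ k - ℤtoℚ b * p^ j
        ≡⟨ cong₂ _-_ (ℤtoℚ-homo-* a _) (ℤtoℚ-homo-* b _) ⟨
      ℤtoℚ a′ - ℤtoℚ b′
        ≡⟨ ℤtoℚ-homo-sub a′ b′ ⟨
      ℤtoℚ (a′ ℤ.- b′) ∎)
    where open ≡-Reasoning
          open ℚSolver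
          a′ = a ℤ.* + (p ℕ.^ k)
          b′ = b ℤ.* + (p ℕ.^ j)

  InZ1/p-mul : ∀ {x y} → InZ1/p p x → InZ1/p p y → InZ1/p p (x * y)
  InZ1/p-mul {x} {y} (j , a , x*p^j≡a) (k , b , y*p^k≡b) = j ℕ.+ k , a ℤ.* b , (begin
    (x * y) * p^ (j ℕ.+ k)    ≡⟨ cong ((x * y) *_) (p^-+ j k) ⟩
    (x * y) * (p^ j * p^ k)   ≡⟨ solve 4 (λ x y a b → (x :* y) :* (a :* b) := (x :* a) :* (y :* b)) refl x y (p^ j) (p^ k) ⟩
    (x * p^ j) * (y * p^ k)   ≡⟨ cong₂ _*_ x*p^j≡a y*p^k≡b ⟩
    ℤtoℚ a * ℤtoℚ b           ≡⟨ ℤtoℚ-homo-* a b ⟨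
    ℤtoℚ (a ℤ.* b)            ∎)
    where open ≡-Reasoning
          open ℚSolver

  InZ1/p-p^* : ∀ k m → InZ1/p p (p^ k * ℤtoℚ m)
  InZ1/p-p^* k m = 0 , + (p ℕ.^ k) ℤ.* m , trans (ℚP.*-identityʳ _) (sym (ℤtoℚ-homo-* (+ (p ℕ.^ k)) m))

  p^n∣m*d⇒p^n∣m : ∀ {d} → ¬ p ℕD.∣ d → ∀ n m → p ℕ.^ n ℕD.∣ m ℕ.* d → p ℕ.^ n ℕD.∣ m
  p^n∣m*d⇒p^n∣m p∤d zero    m _ = ℕD.1∣ m
  p^n∣m*d⇒p^n∣m {d} p∤d (suc n) m p^[1+n]∣m*d
    with euclidsLemma m d p-prime (ℕD.m*n∣⇒m∣ p (p ℕ.^ n) p^[1+n]∣m*d)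
  ... | inj₂ p∣d = contradiction p∣d p∤d
  ... | inj₁ (divides m′ refl) =
    subst (p ℕ.* p ℕ.^ n ℕD.∣_) (ℕP.*-comm p m′)
      (ℕD.*-monoʳ-∣ p (p^n∣m*d⇒p^n∣m p∤d n m′
        (ℕD.*-cancelˡ-∣ p (subst (p ℕ.* p ℕ.^ n ℕD.∣_) m′p*d≡p*m′d p^[1+n]∣m*d))))
    where m′p*d≡p*m′d : m′ ℕ.* p ℕ.* d ≡ p ℕ.* (m′ ℕ.* d)
          m′p*d≡p*m′d = trans (cong (ℕ._* d) (ℕP.*-comm m′ p)) (ℕP.*-assoc p m′ d)

  InZ1/p-p^-divisible : ∀ {x d B} k → InZ1/p p x → ¬ p ℕD.∣ d → x * ℕtoℚ d ≡ p^ k * ℤtoℚ B →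
    ∃ λ C → x ≡ p^ k * ℤtoℚ C
  InZ1/p-p^-divisible {x} {d} {B} k (j , A , x*p^j≡A) p∤d x*d≡p^k*B =
    C , *-cancelʳ-≢0 (p^ j) (p^≢0 j) (begin
      x * p^ j                   ≡⟨ x*p^j≡A ⟩
      ℤtoℚ A                     ≡⟨ cong ℤtoℚ (ℤD._∣_.equality p^n∣A) ⟩
      ℤtoℚ (C ℤ.* + (p ℕ.^ n))   ≡⟨ ℤtoℚ-homo-* C _ ⟩
      ℤtoℚ C * p^ n              ≡⟨ cong (ℤtoℚ C *_) (p^-+ k j) ⟩
      ℤtoℚ C * (p^ k * p^ j)     ≡⟨ solve 3 (λ c a b → c :* (a :* b) := a :* c :* b) refl (ℤtoℚ C) (p^ k) (p^ j) ⟩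
      p^ k * ℤtoℚ C * p^ j       ∎)
    where
    open ≡-Reasoning
    open ℚSolver
    n = k ℕ.+ j
    A*d≡B*p^n : A ℤ.* + d ≡ B ℤ.* + (p ℕ.^ n)
    A*d≡B*p^n = ℤtoℚ-injective (begin
      ℤtoℚ (A ℤ.* + d)          ≡⟨ ℤtoℚ-homo-* A (+ d) ⟩
      ℤtoℚ A * ℕtoℚ d           ≡⟨ cong (_* ℕtoℚ d) x*p^j≡A ⟨
      x * p^ j * ℕtoℚ d         ≡⟨ solve 3 (λ x a b → x :* a :* b := x :* b :* a) refl x (p^ j) (ℕtoℚ d) ⟩
      x * ℕtoℚ d * p^ j         ≡⟨ cong (_* p^ j) x*d≡p^k*B ⟩
      p^ k * ℤtoℚ B * p^ j      ≡⟨ solve 3 (λ a b c → a :* b :* c := b :* (a :* c)) refl (p^ k) (ℤtoℚ B) (p^ j) ⟩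
      ℤtoℚ B * (p^ k * p^ j)    ≡⟨ cong (ℤtoℚ B *_) (p^-+ k j) ⟨
      ℤtoℚ B * p^ n             ≡⟨ ℤtoℚ-homo-* B _ ⟨
      ℤtoℚ (B ℤ.* + (p ℕ.^ n))  ∎)
    p^n∣A : + (p ℕ.^ n) ℤD.∣ A
    p^n∣A = ℤD.∣ᵤ⇒∣ (p^n∣m*d⇒p^n∣m p∤d n ℤ.∣ A ∣
              (subst (p ℕ.^ n ℕD.∣_) ∣B∣*p^n≡∣A∣*d (ℕD.n∣m*n ℤ.∣ B ∣)))
      where ∣B∣*p^n≡∣A∣*d = trans (sym (ℤP.abs-* B _)) (trans (cong ℤ.∣_∣ (sym A*d≡B*p^n)) (ℤP.abs-* A (+ d)))
    C = ℤD._∣_.quotient p^n∣A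

  record Coordinates (k : ℕ) (α β : ℚ) : Set where
    field
      t u v    : ℚ
      t∈ℤ[1/p] : InZ1/p p t
      u∈ℤ[1/p] : InZ1/p p u
      m        : ℤ
      m≢0      : m ≢ + 0
      v≡p^k*m  : v ≡ p^ k * ℤtoℚ m
      α*v≡t    : α * v ≡ t
      β*v≡u    : β * v ≡ u

  open Coordinates

  v≢0 : ∀ {k α β} (c : Coordinates k α β) → v c ≢ 0ℚ
  v≢0 {k} c v≡0 = *-≢0 (p^≢0 k) (λ m≡0 → m≢0 c (ℤtoℚ-injective m≡0)) (trans (sym (v≡p^k*m c)) v≡0)

  v∈ℤ[1/p] : ∀ {k α β} (c : Coordinates k α β) → InZ1/p p (v c)
  v∈ℤ[1/p] {k} c = subst (InZ1/p p) (sym (v≡p^k*m c)) (InZ1/p-p^* k (m c))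

  u-bv≡[β-b]v : ∀ {k α β} (c : Coordinates k α β) b → u c - b * v c ≡ (β - b) * v c
  u-bv≡[β-b]v {β = β} c b = begin
    u c - b * v c      ≡⟨ cong (_- b * v c) (β*v≡u c) ⟨
    β * v c - b * v c  ≡⟨ solve 3 (λ x b v → x :* v :- b :* v := (x :- b) :* v) refl β b (v c) ⟩
    (β - b) * v c      ∎
    where open ≡-Reasoning
          open ℚSolver

  u-bv∈p^[1+k]ℤ : ∀ {k α β} (c : Coordinates k α β) → ∃ λ C → u c - s p β * v c ≡ p^ (suc k) * ℤtoℚ C
  u-bv∈p^[1+k]ℤ {k} {β = β} c =
    InZ1/p-p^-divisible {u c - b * v c} {d} {K ℤ.* m c} (suc k)
      (InZ1/p-sub {u c} {b * v c} (u∈ℤ[1/p] c) (InZ1/p-mul {b} {v c} (s∈ℤ[1/p] β) (v∈ℤ[1/p] c))) p∤d (begin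
        (u c - b * v c) * ℕtoℚ d         ≡⟨ cong (_* ℕtoℚ d) (u-bv≡[β-b]v c b) ⟩
        (β - b) * v c * ℕtoℚ d           ≡⟨ solve 3 (λ x y z → x :* y :* z := x :* z :* y) refl (β - b) (v c) (ℕtoℚ d) ⟩
        (β - b) * ℕtoℚ d * v c           ≡⟨ cong₂ _*_ [β-b]*d≡P*K (v≡p^k*m c) ⟩
        P * ℤtoℚ K * (p^ k * ℤtoℚ (m c))
          ≡⟨ solve 4 (λ P K Q m → P :* K :* (Q :* m) := (P :* Q) :* (K :* m)) refl P (ℤtoℚ K) (p^ k) (ℤtoℚ (m c)) ⟩
        P * p^ k * (ℤtoℚ K * ℤtoℚ (m c)) ≡⟨ cong₂ _*_ (ℕtoℚ-homo-* p (p ℕ.^ k)) (ℤtoℚ-homo-* K (m c)) ⟨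
        p^ (suc k) * ℤtoℚ (K ℤ.* m c)    ∎)
    where
    open ≡-Reasoning
    open ℚSolver
    b = s p β
    remainder = s-remainder β
    d = proj₁ remainder
    K = proj₁ (proj₂ remainder)
    p∤d = proj₁ (proj₂ (proj₂ remainder))
    [β-b]*d≡P*K = proj₂ (proj₂ (proj₂ remainder))

  step : ∀ {k α β} → β ≢ s p β → Coordinates k α β →
    Coordinates (suc k) (inv (β - s p β)) ((α - s p α) * inv (β - s p β))
  step {k} {α} {β} β≢b c = record
    { t = v c ; u = t c - a * v c ; v = u c - b * v c
    ; t∈ℤ[1/p] = v∈ℤ[1/p] c
    ; u∈ℤ[1/p] = InZ1/p-sub {t c} {a * v c} (t∈ℤ[1/p] c) (InZ1/p-mul {a} {v c} (s∈ℤ[1/p] α) (v∈ℤ[1/p] c))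
    ; m = C ; m≢0 = C≢0 ; v≡p^k*m = u-bv≡p^[1+k]*C
    ; α*v≡t = begin
        inv δ * (u c - b * v c) ≡⟨ cong (inv δ *_) (u-bv≡[β-b]v c b) ⟩
        inv δ * (δ * v c)       ≡⟨ ℚP.*-assoc (inv δ) δ (v c) ⟨
        inv δ * δ * v c         ≡⟨ cong (_* v c) (inv-inverseˡ δ≢0) ⟩
        1ℚ * v c                ≡⟨ ℚP.*-identityˡ (v c) ⟩
        v c                     ∎
    ; β*v≡u = begin
        (α - a) * inv δ * (u c - b * v c) ≡⟨ cong ((α - a) * inv δ *_) (u-bv≡[β-b]v c b) ⟩
        (α - a) * inv δ * (δ * v c)
          ≡⟨ solve 4 (λ x i d v → x :* i :* (d :* v) := (x :* v) :* (i :* d)) refl (α - a) (inv δ) δ (v c) ⟩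
        (α - a) * v c * (inv δ * δ)       ≡⟨ cong ((α - a) * v c *_) (inv-inverseˡ δ≢0) ⟩
        (α - a) * v c * 1ℚ                ≡⟨ solve 3 (λ x a v → (x :- a) :* v :* con 1ℚ := x :* v :- a :* v) refl α a (v c) ⟩
        α * v c - a * v c                 ≡⟨ cong (_- a * v c) (α*v≡t c) ⟩
        t c - a * v c                     ∎
    }
    where
    open ≡-Reasoning
    open ℚSolver
    a = s p α
    b = s p β
    δ = β - b
    δ≢0 = x≢y⇒x-y≢0 β≢b
    C = proj₁ (u-bv∈p^[1+k]ℤ c)
    u-bv≡p^[1+k]*C = proj₂ (u-bv∈p^[1+k]ℤ c)
    C≢0 : C ≢ + 0
    C≢0 C≡0 = *-≢0 δ≢0 (v≢0 c) (begin
      δ * v c                  ≡⟨ u-bv≡[β-b]v c b ⟨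
      u c - b * v c            ≡⟨ u-bv≡p^[1+k]*C ⟩
      p^ (suc k) * ℤtoℚ C      ≡⟨ cong (λ z → p^ (suc k) * ℤtoℚ z) C≡0 ⟩
      p^ (suc k) * 0ℚ          ≡⟨ ℚP.*-zeroʳ (p^ (suc k)) ⟩
      0ℚ                       ∎)

  initialCoordinates : ∀ {t u} v → InZ1/p p t → InZ1/p p u → v ≢ + 0 →
    Coordinates 0 (t * inv (ℤtoℚ v)) (u * inv (ℤtoℚ v))
  initialCoordinates {t} {u} v t∈ u∈ v≢0 = record
    { t = t ; u = u ; v = ℤtoℚ v ; t∈ℤ[1/p] = t∈ ; u∈ℤ[1/p] = u∈
    ; m = v ; m≢0 = v≢0 ; v≡p^k*m = sym (ℚP.*-identityˡ (ℤtoℚ v))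
    ; α*v≡t = *-inv-cancelʳ t V≢0 ; β*v≡u = *-inv-cancelʳ u V≢0 }
    where V≢0 = λ v≡0 → v≢0 (ℤtoℚ-injective v≡0)

  p^k≤∣v∣ : ∀ {k α β} (c : Coordinates k α β) → p^ k ≤ ∣ v c ∣
  p^k≤∣v∣ {k} c = begin
    p^ k                        ≡⟨ ℚP.*-identityʳ (p^ k) ⟨
    p^ k * 1ℚ                   ≤⟨ *-monoˡ-≤-nonNeg′ (ℚP.<⇒≤ (p^-pos k)) 1≤∣m∣ ⟩
    p^ k * ℕtoℚ ℤ.∣ m c ∣       ≡⟨ cong₂ _*_ (ℚP.0≤p⇒∣p∣≡p (ℚP.<⇒≤ (p^-pos k))) (∣ℤtoℚ∣ (m c)) ⟨
    ∣ p^ k ∣ * ∣ ℤtoℚ (m c) ∣   ≡⟨ ℚP.∣p*q∣≡∣p∣*∣q∣ (p^ k) (ℤtoℚ (m c)) ⟨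
    ∣ p^ k * ℤtoℚ (m c) ∣       ≡⟨ cong ∣_∣ (v≡p^k*m c) ⟨
    ∣ v c ∣                     ∎
    where
    open ℚP.≤-Reasoning
    1≤∣m∣ : 1ℚ ≤ ℕtoℚ ℤ.∣ m c ∣
    1≤∣m∣ = ℤtoℚ-mono-≤ (ℤ.+≤+ (ℕP.n≢0⇒n>0 (λ ∣m∣≡0 → m≢0 c (ℤP.∣i∣≡0⇒i≡0 ∣m∣≡0))))

  potentialOf : ∀ {k α β} → ℚ → Coordinates k α β → ℚ
  potentialOf r c = potential r (t c) (u c) (v c)

  module _ (p-odd : p % 2 ≡ 1) {r : ℚ} (0≤r : 0ℚ ≤ r)
           (contraction : r * r * (½ * P) + r * (½ * P) + 1ℚ ≤ r * r * r) where

    step-contracts : ∀ {k α β} (β≢b : β ≢ s p β) (c : Coordinates k α β) →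
      potentialOf r (step β≢b c) ≤ r * potentialOf r c
    step-contracts {α = α} {β} _ c = potential-contracts (s p α) (s p β) (t c) (u c) (v c) 0≤r
      (∣s∣≤½p α p-odd) (∣s∣≤½p β p-odd) contraction

    iterate : ∀ N {k α β α′ β′} → JP p N α β ≡ just (α′ , β′) → (c : Coordinates k α β) →
      Σ (Coordinates (N ℕ.+ k) α′ β′) λ c′ → potentialOf r c′ ≤ pow r N * potentialOf r c
    iterate zero refl c = c , ℚP.≤-reflexive (sym (ℚP.*-identityˡ _))
    iterate (suc N) {k} {α} {β} {α′} {β′} JP≡ c with β≢b , JP′≡ ← JP-suc N α β JP≡
      with c′ , c′≤ ← iterate N JP′≡ (step β≢b c) =
      subst (λ j → Σ (Coordinates j α′ β′) λ c″ → potentialOf r c″ ≤ pow r (suc N) * potentialOf r c)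
        (ℕP.+-suc N k) (c′ , (begin
          potentialOf r c′                        ≤⟨ c′≤ ⟩
          pow r N * potentialOf r (step β≢b c)    ≤⟨ *-monoˡ-≤-nonNeg′ (pow-nonNeg N 0≤r) (step-contracts β≢b c) ⟩
          pow r N * (r * potentialOf r c)
            ≡⟨ solve 3 (λ a r x → a :* (r :* x) := r :* a :* x) refl (pow r N) r (potentialOf r c) ⟩
          r * pow r N * potentialOf r c           ∎))
      where open ℚP.≤-Reasoning
            open ℚSolver

    r²p^N≤r^N*potential : ∀ N {α β α′ β′} → JP p N α β ≡ just (α′ , β′) → (c : Coordinates 0 α β) →
      r * r * p^ N ≤ pow r N * potentialOf r c
    r²p^N≤r^N*potential N JP≡ c with c′ , c′≤ ← iterate N JP≡ c = begin
      r * r * p^ N            ≡⟨ cong (λ k → r * r * p^ k) (ℕP.+-identityʳ N) ⟨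
      r * r * p^ (N ℕ.+ 0)    ≤⟨ *-monoˡ-≤-nonNeg′ (nonNeg-* 0≤r 0≤r) (p^k≤∣v∣ c′) ⟩
      r * r * ∣ v c′ ∣        ≤⟨ r²∣v∣≤potential (t c′) (u c′) (v c′) 0≤r ⟩
      potentialOf r c′         ≤⟨ c′≤ ⟩
      pow r N * potentialOf r c ∎
      where open ℚP.≤-Reasoning

  cubic-pos⇒contraction : ∀ {q} → 0ℚ < cubic p q →
    (P * q) * (P * q) * (½ * P) + (P * q) * (½ * P) + 1ℚ < (P * q) * (P * q) * (P * q)
  cubic-pos⇒contraction {q} 0<f = 0<y-x⇒x<y (subst (0ℚ <_) p³*f≡ (pos-* (p^-pos 3) 0<f))
    where
    open ≡-Reasoning
    open ℚSolver
    r = P * q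
    h = ½ * P
    I₁ = inv (ℕtoℚ (2 ℕ.* p))
    I₃ = inv (ℕtoℚ (p ℕ.^ 3))
    I₁*2P≡1 : I₁ * (ℕtoℚ 2 * P) ≡ 1ℚ
    I₁*2P≡1 = trans (cong (I₁ *_) (sym (ℕtoℚ-homo-* 2 p))) (inv-inverseˡ (ℕtoℚ-≢0 (2 ℕ.* p) {{ℕP.m*n≢0 2 p}}))
    p³*f≡ : p^ 3 * cubic p q ≡ r * r * r - (r * r * h + r * h + 1ℚ)
    p³*f≡ = begin
      p^ 3 * cubic p q
        ≡⟨ cong (_* cubic p q) (ℕtoℚ-homo-^ p 3) ⟩
      pow P 3 * cubic p q
        ≡⟨ solve 4 (λ P q I₁ I₃ →
             P :* (P :* (P :* con 1ℚ)) :* (q :* (q :* (q :* con 1ℚ)) :- con ½ :* (q :* (q :* con 1ℚ)) :- I₁ :* q :- I₃)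
             := (P :* q) :* (P :* q) :* (P :* q)
                :- ((P :* q) :* (P :* q) :* (con ½ :* P) :+ (P :* q) :* (con ½ :* P) :* (I₁ :* (con (ℕtoℚ 2) :* P))
                    :+ I₃ :* (P :* (P :* (P :* con 1ℚ)))))
             refl P q I₁ I₃ ⟩
      r * r * r - (r * r * h + r * h * (I₁ * (ℕtoℚ 2 * P)) + I₃ * pow P 3)
        ≡⟨ cong₂ (λ x y → r * r * r - (r * r * h + r * h * x + y)) I₁*2P≡1
                 (trans (cong (I₃ *_) (sym (ℕtoℚ-homo-^ p 3))) (inv-inverseˡ (p^≢0 3))) ⟩
      r * r * r - (r * r * h + r * h * 1ℚ + 1ℚ)
        ≡⟨ cong (λ x → r * r * r - (r * r * h + x + 1ℚ)) (ℚP.*-identityʳ (r * h)) ⟩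
      r * r * r - (r * r * h + r * h + 1ℚ) ∎

corollary13 : (p : ℕ) → Prime p → p % 2 ≡ 1 →
    (n : ℕ) (t u : ℚ) (v : ℤ) → InZ1/p p t → InZ1/p p u → v ≢ + 0 →
    LengthAtLeast p (suc n) (t * inv (ℤtoℚ v)) (u * inv (ℤtoℚ v)) →
    (q : ℚ) → AboveX̃ p q →
    1ℚ ≤ ℤtoℚ (+ 3) * (∣ t ∣ ⊔ ∣ u ∣ ⊔ ∣ ℤtoℚ v ∣) * pow q n
corollary13 p p-prime p-odd n t u v t∈ u∈ v≢+0 length q (0<q , 0<f[q]) =
  ℚP.*-cancelʳ-≤-pos (r * r * p^ n) {{ℚ.positive (pos-* (pos-* 0<r 0<r) (p^-pos n))}} (begin
    1ℚ * (r * r * p^ n)              ≡⟨ ℚP.*-identityˡ _ ⟩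
    r * r * p^ n                     ≤⟨ r²p^N≤r^N*potential p-odd (ℚP.<⇒≤ 0<r) contraction n JP≡ c₀ ⟩
    pow r n * potentialOf r c₀
      ≤⟨ *-monoˡ-≤-nonNeg′ (pow-nonNeg n (ℚP.<⇒≤ 0<r)) (potential≤3r²max t u (ℤtoℚ v) 1≤r) ⟩
    pow r n * (ℕtoℚ 3 * (r * r) * M) ≡⟨ cong (_* (ℕtoℚ 3 * (r * r) * M)) r^n≡p^n*q^n ⟩
    p^ n * pow q n * (ℕtoℚ 3 * (r * r) * M)
      ≡⟨ solve 5 (λ a b c r M → a :* b :* (c :* (r :* r) :* M) := c :* M :* b :* (r :* r :* a)) refl (p^ n) (pow q n) (ℕtoℚ 3) r M ⟩
    ℤtoℚ (+ 3) * M * pow q n * (r * r * p^ n) ∎)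
  where
  open JacobiPerron p-prime
  open ℚP.≤-Reasoning
  open ℚSolver
  M = ∣ t ∣ ⊔ ∣ u ∣ ⊔ ∣ ℤtoℚ v ∣
  r = P * q
  0<r = pos-* P-pos 0<q
  r^n≡p^n*q^n = trans (pow-distrib-* P q n) (cong (_* pow q n) (sym (ℕtoℚ-homo-^ p n)))
  contraction = ℚP.<⇒≤ (cubic-pos⇒contraction 0<f[q])
  1≤r = contraction⇒1≤r (ℚP.<⇒≤ 0<r) (nonNeg-* (ℚP.<⇒≤ (ℚP.positive⁻¹ ½)) (ℚP.<⇒≤ P-pos)) contraction
  c₀ = initialCoordinates v t∈ u∈ v≢+0
  JP≡ = proj₂ (JP-suc⇒JP n _ _ (proj₂ (lengthAtLeast⇒JP (suc n) (t * inv (ℤtoℚ v)) (u * inv (ℤtoℚ v)) length)))
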